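{- For every integer $n \ge 5$, the graph $R''_n$ satisfies $\mathrm{eqdim}(R''_n) \ge 3n$.
   Context: All graphs are finite, simple, connected and undirected; $d(u,v)$ denotes the number of edges of a shortest path between $u$ and $v$. A vertex $x$ is equidistant from $u$ and $v$ if $d(u,x)=d(v,x)$. A set $S\subseteq V(G)$ is a distance-equalizer set of $G$ if for every pair of distinct vertices $u,v\in V(G)\setminus S$ there is $x\in S$ equidistant from $u$ and $v$. The equidistant dimension $\mathrm{eqdim}(G)$ is the minimum cardinality of a distance-equalizer set of $G$. The graph $R''_n$ has vertex set $\{a_i,b_i,c_i,d_i,e_i,f_i : i=0,\dots,n-1\}$ and edge set $\{a_ia_{i+1}, f_if_{i+1}, a_ib_i, c_id_i, e_if_i, b_ic_i, b_{i+1}c_i, d_ie_i, d_{i+1}e_i : i=0,\dots,n-1\}$, with indices taken modulo $n$. -}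

module Defs where

open import Data.Nat using (ℕ; zero; suc; _<_)
open import Data.Nat.DivMod using (_mod_)
open import Data.Fin using (Fin; toℕ)
open import Data.Product using (Σ; _×_; ∃)
open import Data.Sum using (_⊎_)
open import Data.List using (List; length)
open import Data.List.Membership.Propositional using (_∈_; _∉_)
open import Data.List.Relation.Unary.Unique.Propositional using (Unique)
open import Relation.Binary.PropositionalEquality using (_≡_)
open import Relation.Nullary using (¬_)

next : {n : ℕ} → Fin n → Fin n
next {suc m} i = suc (toℕ i) mod (suc m)

data V (n : ℕ) : Set where
  a b c d e f : Fin n → V n

data E {n : ℕ} : V n → V n → Set where
  aa : ∀ i → E (a i) (a (next i))
  ff : ∀ i → E (f i) (f (next i))
  ab : ∀ i → E (a i) (b i)
  cd : ∀ i → E (c i) (d i)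
  ef : ∀ i → E (e i) (f i)
  bc : ∀ i → E (b i) (c i)
  b'c : ∀ i → E (b (next i)) (c i)
  de : ∀ i → E (d i) (e i)
  d'e : ∀ i → E (d (next i)) (e i)

Adj : {n : ℕ} → V n → V n → Set
Adj u v = E u v ⊎ E v u

data Walk {n : ℕ} : V n → V n → ℕ → Set where
  here : ∀ {u} → Walk u u 0
  step : ∀ {u v w k} → Adj u v → Walk v w k → Walk u w (suc k)

Dist : {n : ℕ} → V n → V n → ℕ → Set
Dist u v k = Walk u v k × (∀ m → m < k → ¬ Walk u v m)

Equidistant : {n : ℕ} → V n → V n → V n → Set
Equidistant u v x = ∃ λ k → Dist u x k × Dist v x k

IsDistanceEqualizer : (n : ℕ) → List (V n) → Set
IsDistanceEqualizer n S =
  ∀ (u v : V n) → u ∉ S → v ∉ S → u ≢ v → Σ (V n) λ x → x ∈ S × Equidistant u v x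
  where
  _≢_ : V n → V n → Set
  p ≢ q = ¬ (p ≡ q)

{-# OPTIONS --safe #-}
-- R''_n has a mirror automorphism σ exchanging the upper half {a, b, c} with the lower
-- half {d, e, f}, and the only edges between the halves are the rungs c_i d_i = v σ(v).
-- Reflecting a walk up to its first rung shows that every vertex is strictly closer to
-- whichever of v, σ(v) lies on its own half, so no vertex is equidistant from them.
-- Hence a distance-equalizer set meets each of the 3n orbits {v, σ(v)}.

module Submission where

open import Defs
open import Data.Nat using (ℕ; zero; suc; _+_; _*_; _%_; _≤_; _<_; NonZero; z≤n; s≤s)
open import Data.Nat.Properties using (+-comm; +-suc; n<1+n)
open import Data.Nat.DivMod
  using (_mod_; %-distribˡ-+; m%n%n≡m%n; m%n<n; [m+n]%n≡m%n; m<n⇒m%n≡m)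
open import Data.Bool using (Bool; true; false)
import Data.Bool.Properties as Bool
open import Data.Fin using (Fin; toℕ; remQuot; combine; #_) renaming (zero to 0F; suc to sucF)
open import Data.Fin.Properties using (toℕ-fromℕ<; toℕ-injective; toℕ<n; combine-remQuot; injective⇒≤)
import Data.Fin.Properties as Fin
open import Data.Product using (_×_; _,_; proj₁; proj₂; ∃; uncurry)
import Data.Product.Properties as Product
open import Data.Sum using (inj₁; inj₂; swap)
open import Data.List using (List; length; lookup)
open import Data.List.Relation.Unary.Unique.Propositional using (Unique)
open import Data.Empty using (⊥-elim)
open import Data.List.Relation.Unary.Any using (index)
open import Data.List.Relation.Unary.Any.Properties using (lookup-index)
open import Data.List.Membership.Propositional using (_∈_)
import Data.List.Membership.DecPropositional as DecMembership
open import Function using (_∘_)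
open import Relation.Nullary using (¬_; yes; no)
open import Relation.Nullary.Decidable using (map′)
open import Relation.Binary.Definitions using (DecidableEquality)
open import Relation.Binary.PropositionalEquality
open ≡-Reasoning

toℕ-mod : ∀ x n .{{_ : NonZero n}} → toℕ (x mod n) ≡ x % n
toℕ-mod x n = toℕ-fromℕ< (m%n<n x n)

[m%n+o]%n≡[m+o]%n : ∀ x y n .{{_ : NonZero n}} → (x % n + y) % n ≡ (x + y) % n
[m%n+o]%n≡[m+o]%n x y n = begin
  (x % n + y) % n         ≡⟨ %-distribˡ-+ (x % n) y n ⟩
  (x % n % n + y % n) % n ≡⟨ cong (λ z → (z + y % n) % n) (m%n%n≡m%n x n) ⟩
  (x % n + y % n) % n     ≡⟨ %-distribˡ-+ x y n ⟨
  (x + y) % n             ∎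

[m+o%n]%n≡[m+o]%n : ∀ x y n .{{_ : NonZero n}} → (x + y % n) % n ≡ (x + y) % n
[m+o%n]%n≡[m+o]%n x y n = begin
  (x + y % n) % n ≡⟨ cong (_% n) (+-comm x (y % n)) ⟩
  (y % n + x) % n ≡⟨ [m%n+o]%n≡[m+o]%n y x n ⟩
  (y + x) % n     ≡⟨ cong (_% n) (+-comm y x) ⟩
  (x + y) % n     ∎

surjective-on-list⇒≤ : ∀ {A : Set} {k} (S : List A) (φ : A → Fin k) →
                        (∀ i → ∃ λ w → w ∈ S × φ w ≡ i) → k ≤ length S
surjective-on-list⇒≤ S φ covers = injective⇒≤ position-injective
  where
  position : ∀ i → Fin (length S)
  position i = index (proj₁ (proj₂ (covers i)))

  φ-lookup-position : ∀ i → φ (lookup S (position i)) ≡ i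
  φ-lookup-position i with covers i
  ... | w , w∈S , φw≡i = trans (cong φ (sym (lookup-index w∈S))) φw≡i

  position-injective : ∀ {i j} → position i ≡ position j → i ≡ j
  position-injective {i} {j} eq = begin
    i                             ≡⟨ φ-lookup-position i ⟨
    φ (lookup S (position i))     ≡⟨ cong (φ ∘ lookup S) eq ⟩
    φ (lookup S (position j))     ≡⟨ φ-lookup-position j ⟩
    j                             ∎

module _ {m : ℕ} where

  prev : Fin (suc m) → Fin (suc m)
  prev i = (toℕ i + m) mod suc m

  private
    [i+n]%n≡i : ∀ (i : Fin (suc m)) → (toℕ i + suc m) % suc m ≡ toℕ i
    [i+n]%n≡i i = trans ([m+n]%n≡m%n (toℕ i) (suc m)) (m<n⇒m%n≡m (toℕ<n i))

  prev-next : ∀ i → prev (next i) ≡ i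
  prev-next i = toℕ-injective (begin
    toℕ (prev (next i))                   ≡⟨ toℕ-mod (toℕ (next i) + m) (suc m) ⟩
    (toℕ (next i) + m) % suc m            ≡⟨ cong (λ z → (z + m) % suc m) (toℕ-mod (suc (toℕ i)) (suc m)) ⟩
    (suc (toℕ i) % suc m + m) % suc m     ≡⟨ [m%n+o]%n≡[m+o]%n (suc (toℕ i)) m (suc m) ⟩
    (suc (toℕ i) + m) % suc m             ≡⟨ cong (_% suc m) (+-suc (toℕ i) m) ⟨
    (toℕ i + suc m) % suc m               ≡⟨ [i+n]%n≡i i ⟩
    toℕ i                                 ∎)

  next-prev : ∀ i → next (prev i) ≡ i
  next-prev i = toℕ-injective (begin
    toℕ (next (prev i))                   ≡⟨ toℕ-mod (suc (toℕ (prev i))) (suc m) ⟩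
    (1 + toℕ (prev i)) % suc m            ≡⟨ cong (λ z → (1 + z) % suc m) (toℕ-mod (toℕ i + m) (suc m)) ⟩
    (1 + (toℕ i + m) % suc m) % suc m     ≡⟨ [m+o%n]%n≡[m+o]%n 1 (toℕ i + m) (suc m) ⟩
    suc (toℕ i + m) % suc m               ≡⟨ cong (_% suc m) (+-suc (toℕ i) m) ⟨
    (toℕ i + suc m) % suc m               ≡⟨ [i+n]%n≡i i ⟩
    toℕ i                                 ∎)

  mirror : V (suc m) → V (suc m)
  mirror (a i) = f (prev i)
  mirror (b i) = e (prev i)
  mirror (c i) = d i
  mirror (d i) = c i
  mirror (e i) = b (next i)
  mirror (f i) = a (next i)

  mirror-involutive : ∀ v → mirror (mirror v) ≡ v
  mirror-involutive (a i) = cong a (next-prev i)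
  mirror-involutive (b i) = cong b (next-prev i)
  mirror-involutive (c i) = refl
  mirror-involutive (d i) = refl
  mirror-involutive (e i) = cong e (prev-next i)
  mirror-involutive (f i) = cong f (prev-next i)

  mirror-edge : ∀ {u v} → E u v → Adj (mirror u) (mirror v)
  mirror-edge (aa i) rewrite prev-next i =
    inj₁ (subst (E (f (prev i)) ∘ f) (next-prev i) (ff (prev i)))
  mirror-edge (ff i)  = inj₁ (aa (next i))
  mirror-edge (ab i)  = inj₂ (ef (prev i))
  mirror-edge (cd i)  = inj₂ (cd i)
  mirror-edge (ef i)  = inj₂ (ab (next i))
  mirror-edge (bc i)  = inj₂ (subst (λ j → E (d j) (e (prev i))) (next-prev i) (d'e (prev i)))
  mirror-edge (b'c i) rewrite prev-next i = inj₂ (de i)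
  mirror-edge (de i)  = inj₂ (b'c i)
  mirror-edge (d'e i) = inj₂ (bc (next i))

  mirror-adjacent : ∀ {u v} → Adj u v → Adj (mirror u) (mirror v)
  mirror-adjacent (inj₁ uv) = mirror-edge uv
  mirror-adjacent (inj₂ vu) = swap (mirror-edge vu)

  upper : V (suc m) → Bool
  upper (a _) = true
  upper (b _) = true
  upper (c _) = true
  upper (d _) = false
  upper (e _) = false
  upper (f _) = false

  upper-mirror : ∀ v → upper (mirror v) ≢ upper v
  upper-mirror (a _) ()
  upper-mirror (b _) ()
  upper-mirror (c _) ()
  upper-mirror (d _) ()
  upper-mirror (e _) ()
  upper-mirror (f _) ()

  edge-across⇒mirror : ∀ {u v} → E u v → upper u ≢ upper v → v ≡ mirror u × u ≡ mirror v
  edge-across⇒mirror (cd i)  _   = refl , refl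
  edge-across⇒mirror (aa i)  u≢v = ⊥-elim (u≢v refl)
  edge-across⇒mirror (ff i)  u≢v = ⊥-elim (u≢v refl)
  edge-across⇒mirror (ab i)  u≢v = ⊥-elim (u≢v refl)
  edge-across⇒mirror (ef i)  u≢v = ⊥-elim (u≢v refl)
  edge-across⇒mirror (bc i)  u≢v = ⊥-elim (u≢v refl)
  edge-across⇒mirror (b'c i) u≢v = ⊥-elim (u≢v refl)
  edge-across⇒mirror (de i)  u≢v = ⊥-elim (u≢v refl)
  edge-across⇒mirror (d'e i) u≢v = ⊥-elim (u≢v refl)

  adjacent-across⇒mirror : ∀ {u v} → Adj u v → upper u ≢ upper v → v ≡ mirror u
  adjacent-across⇒mirror (inj₁ uv) u≢v = proj₁ (edge-across⇒mirror uv u≢v)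
  adjacent-across⇒mirror (inj₂ vu) u≢v = proj₂ (edge-across⇒mirror vu (u≢v ∘ sym))

  walk-across⇒shorter-from-mirror : ∀ {y x k} → Walk y x k → upper y ≢ upper x →
                                    ∃ λ k′ → k′ < k × Walk (mirror y) x k′
  walk-across⇒shorter-from-mirror here y≢x = ⊥-elim (y≢x refl)
  walk-across⇒shorter-from-mirror {y} (step {v = v} yv vx) y≢x with upper y Bool.≟ upper v
  ... | no  y≢v = _ , n<1+n _ , subst (λ z → Walk z _ _) (adjacent-across⇒mirror yv y≢v) vx
  ... | yes y≡v with walk-across⇒shorter-from-mirror vx (y≢x ∘ trans y≡v)
  ...   | k′ , k′<k , vx′ = suc k′ , s≤s k′<k , step (mirror-adjacent yv) vx′

  mirror-not-equidistant : ∀ u x → ¬ Equidistant u (mirror u) x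
  mirror-not-equidistant u x (k , (ux , ux-min) , (u′x , u′x-min)) with upper x Bool.≟ upper u
  ... | yes x≡u with walk-across⇒shorter-from-mirror u′x (λ eq → upper-mirror u (trans eq x≡u))
  ...   | k′ , k′<k , u″x = ux-min k′ k′<k (subst (λ z → Walk z x k′) (mirror-involutive u) u″x)
  mirror-not-equidistant u x (k , (ux , ux-min) , (u′x , u′x-min)) | no x≢u
    with walk-across⇒shorter-from-mirror ux (x≢u ∘ sym)
  ...   | k′ , k′<k , u′x′ = u′x-min k′ k′<k u′x′

  encode : V (suc m) → Fin 6 × Fin (suc m)
  encode (a i) = # 0 , i
  encode (b i) = # 1 , i
  encode (c i) = # 2 , i
  encode (d i) = # 3 , i
  encode (e i) = # 4 , i
  encode (f i) = # 5 , i

  encode-injective : ∀ {u v} → encode u ≡ encode v → u ≡ v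
  encode-injective {a _} {a _} refl = refl
  encode-injective {b _} {b _} refl = refl
  encode-injective {c _} {c _} refl = refl
  encode-injective {d _} {d _} refl = refl
  encode-injective {e _} {e _} refl = refl
  encode-injective {f _} {f _} refl = refl

  _≟_ : DecidableEquality (V (suc m))
  u ≟ v = map′ encode-injective (cong encode) (Product.≡-dec Fin._≟_ Fin._≟_ (encode u) (encode v))

  orbit : V (suc m) → Fin 3 × Fin (suc m)
  orbit (a i) = # 0 , i
  orbit (b i) = # 1 , i
  orbit (c i) = # 2 , i
  orbit (d i) = # 2 , i
  orbit (e i) = # 1 , next i
  orbit (f i) = # 0 , next i

  orbit-mirror : ∀ v → orbit (mirror v) ≡ orbit v
  orbit-mirror (a i) = cong (# 0 ,_) (next-prev i)
  orbit-mirror (b i) = cong (# 1 ,_) (next-prev i)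
  orbit-mirror (c i) = refl
  orbit-mirror (d i) = refl
  orbit-mirror (e i) = refl
  orbit-mirror (f i) = refl

  upperVertex : Fin 3 × Fin (suc m) → V (suc m)
  upperVertex (0F , i)             = a i
  upperVertex (sucF 0F , i)        = b i
  upperVertex (sucF (sucF 0F) , i) = c i

  orbit-upperVertex : ∀ p → orbit (upperVertex p) ≡ p
  orbit-upperVertex (0F , i)             = refl
  orbit-upperVertex (sucF 0F , i)        = refl
  orbit-upperVertex (sucF (sucF 0F) , i) = refl

  open DecMembership _≟_ using (_∈?_)

  equalizer-meets-orbit : ∀ {S} → IsDistanceEqualizer (suc m) S →
                          ∀ v → ∃ λ w → w ∈ S × orbit w ≡ orbit v
  equalizer-meets-orbit {S} equalizer v with v ∈? S | mirror v ∈? S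
  ... | yes v∈S | _        = v , v∈S , refl
  ... | no _    | yes v′∈S = mirror v , v′∈S , orbit-mirror v
  ... | no v∉S  | no v′∉S
    with equalizer v (mirror v) v∉S v′∉S (λ v≡v′ → upper-mirror v (cong upper (sym v≡v′)))
  ...   | x , _ , equidistant = ⊥-elim (mirror-not-equidistant v x equidistant)

  3n≤length-equalizer : ∀ S → IsDistanceEqualizer (suc m) S → 3 * suc m ≤ length S
  3n≤length-equalizer S equalizer = surjective-on-list⇒≤ S (uncurry combine ∘ orbit) covers
    where
    covers : ∀ i → ∃ λ w → w ∈ S × uncurry combine (orbit w) ≡ i
    covers i with equalizer-meets-orbit equalizer (upperVertex (remQuot {3} (suc m) i))
    ... | w , w∈S , same-orbit = w , w∈S , (begin
      uncurry combine (orbit w)                ≡⟨ cong (uncurry combine) same-orbit ⟩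
      uncurry combine (orbit (upperVertex p))  ≡⟨ cong (uncurry combine) (orbit-upperVertex p) ⟩
      uncurry combine p                        ≡⟨ combine-remQuot {3} (suc m) i ⟩
      i                                        ∎)
      where p = remQuot {3} (suc m) i

mainTheorem1 : (n : ℕ) → 5 ≤ n → (S : List (V n)) → Unique S →
    IsDistanceEqualizer n S → 3 * n ≤ length S
mainTheorem1 zero    _ _ _ _         = z≤n
mainTheorem1 (suc m) _ S _ equalizer = 3n≤length-equalizer S equalizer
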